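{- Let $\mathcal H,\mathcal L$ be finite families of graphs. Suppose that a graph $G$ is Ramsey for $(\mathcal H,\mathcal L)$, but none of its proper subgraphs is Ramsey for $(\mathcal H,\mathcal L)$. Then $G$ supports an $(\mathcal H,\mathcal L)$-core.
   Context: $G$ is Ramsey for $(\mathcal H,\mathcal L)$ if every red/blue coloring of $E(G)$ contains a red copy of some $H\in\mathcal H$ or a blue copy of some $L\in\mathcal L$. Let $\mathcal F_{\mathcal H}[G]$ (resp. $\mathcal F_{\mathcal L}[G]$) be the set of all copies of members of $\mathcal H$ (resp. $\mathcal L$) in $G$, each copy viewed as a set of edges of $G$; these are hypergraphs on the ground set $E(G)$. An $(\mathcal H,\mathcal L)$-core is a tuple $(G,\mathcal F_{\mathcal H},\mathcal F_{\mathcal L})$ with $\mathcal F_{\mathcal H}\subseteq\mathcal F_{\mathcal H}[G]$, $\mathcal F_{\mathcal L}\subseteq\mathcal F_{\mathcal L}[G]$ such that: the hypergraph $\mathcal F_{\mathcal H}\cup\mathcal F_{\mathcal L}$ is connected and every edge of $G$ lies in some member of it; for every $\hat H\in\mathcal F_{\mathcal H}$ and every $e\in\hat H$ there is $\hat L\in\mathcal F_{\mathcal L}$ with $\hat H\cap\hat L=\{e\}$; and for every $\hat L\in\mathcal F_{\mathcal L}$ and every $e\in\hat L$ there is $\hat H\in\mathcal F_{\mathcal H}$ with $\hat H\cap\hat L=\{e\}$. $G$ supports a core if such $\mathcal F_{\mathcal H},\mathcal F_{\mathcal L}$ exist. -}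

module Defs where

open import Data.Nat using (ℕ)
open import Data.Fin using (Fin)
open import Data.Bool using (Bool; true; false)
open import Data.List using (List)
open import Data.List.Membership.Propositional using (_∈_)
open import Data.Product using (Σ; Σ-syntax; ∃; ∃-syntax; _×_; _,_)
open import Data.Sum using (_⊎_)
open import Relation.Nullary using (¬_)
open import Relation.Binary.PropositionalEquality using (_≡_)
open import Relation.Binary.Construct.Closure.ReflexiveTransitive using (Star)
open import Function.Definitions using (Injective)

record Graph : Set where
  field
    n      : ℕ
    adj    : Fin n → Fin n → Bool
    sym    : ∀ u v → adj u v ≡ adj v u
    irrefl : ∀ u → adj u u ≡ false
open Graph public

Edge : (G : Graph) → Fin (n G) → Fin (n G) → Set
Edge G u v = adj G u v ≡ true

SamePair : {k : ℕ} → Fin k → Fin k → Fin k → Fin k → Set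
SamePair a b c d = (a ≡ c × b ≡ d) ⊎ (a ≡ d × b ≡ c)

-- An embedding of H into G: injective vertex map sending edges to edges,
-- i.e. an isomorphism of H onto a (not necessarily induced) subgraph of G.
record Emb (H G : Graph) : Set where
  field
    f    : Fin (n H) → Fin (n G)
    inj  : Injective _≡_ _≡_ f
    pres : ∀ u v → Edge H u v → Edge G (f u) (f v)
open Emb public

InImage : {H G : Graph} → Emb H G → Fin (n G) → Fin (n G) → Set
InImage {H} φ a b = Σ[ u ∈ Fin (n H) ] Σ[ v ∈ Fin (n H) ] (Edge H u v × f φ u ≡ a × f φ v ≡ b)

Proper : {H G : Graph} → Emb H G → Set
Proper {H} {G} φ =
  (Σ[ a ∈ Fin (n G) ] (∀ u → ¬ (f φ u ≡ a)))
  ⊎ (Σ[ a ∈ Fin (n G) ] Σ[ b ∈ Fin (n G) ] (Edge G a b × ¬ InImage φ a b))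

Copy : List Graph → Graph → Set
Copy 𝓕 G = Σ[ H ∈ Graph ] (H ∈ 𝓕 × Emb H G)

-- the edge set of a copy (as a set of edges of G; ab and ba denote the same edge)
InCopy : {𝓕 : List Graph} {G : Graph} → Copy 𝓕 G → Fin (n G) → Fin (n G) → Set
InCopy (H , _ , φ) a b = InImage φ a b

-- red/blue edge colourings of G (true = red, false = blue); only the values on
-- edges matter, symmetry makes the colour of an unordered edge well defined
Colouring : Graph → Set
Colouring G = Σ[ c ∈ (Fin (n G) → Fin (n G) → Bool) ] (∀ a b → c a b ≡ c b a)

Monochromatic : {𝓕 : List Graph} {G : Graph} → Colouring G → Bool → Copy 𝓕 G → Set
Monochromatic {G = G} (c , _) col κ = ∀ a b → InCopy κ a b → c a b ≡ col

Ramsey : List Graph → List Graph → Graph → Set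
Ramsey 𝓗 𝓛 G = (χ : Colouring G) →
  (Σ[ κ ∈ Copy 𝓗 G ] Monochromatic χ true κ) ⊎ (Σ[ κ ∈ Copy 𝓛 G ] Monochromatic χ false κ)

MeetExactly : {𝓗 𝓛 : List Graph} {G : Graph} → Copy 𝓗 G → Copy 𝓛 G → Fin (n G) → Fin (n G) → Set
MeetExactly {G = G} κ λ' a b = ∀ (x y : Fin (n G)) →
  ((InCopy κ x y × InCopy λ' x y) → SamePair x y a b) × (SamePair x y a b → (InCopy κ x y × InCopy λ' x y))

record IsCore (𝓗 𝓛 : List Graph) (G : Graph) (𝓕𝓗 : Copy 𝓗 G → Set) (𝓕𝓛 : Copy 𝓛 G → Set) : Set where
  Linked : (Fin (n G) × Fin (n G)) → (Fin (n G) × Fin (n G)) → Set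
  Linked (a , b) (c , d) =
    (Σ[ κ ∈ Copy 𝓗 G ] (𝓕𝓗 κ × InCopy κ a b × InCopy κ c d))
    ⊎ (Σ[ κ ∈ Copy 𝓛 G ] (𝓕𝓛 κ × InCopy κ a b × InCopy κ c d))
  field
    covering  : ∀ a b → Edge G a b →
      (Σ[ κ ∈ Copy 𝓗 G ] (𝓕𝓗 κ × InCopy κ a b)) ⊎ (Σ[ κ ∈ Copy 𝓛 G ] (𝓕𝓛 κ × InCopy κ a b))
    connected : ∀ a b c d → Edge G a b → Edge G c d → Star Linked (a , b) (c , d)
    H-side    : ∀ (κ : Copy 𝓗 G) → 𝓕𝓗 κ → ∀ a b → InCopy κ a b →
      Σ[ λ' ∈ Copy 𝓛 G ] (𝓕𝓛 λ' × MeetExactly κ λ' a b)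
    L-side    : ∀ (λ' : Copy 𝓛 G) → 𝓕𝓛 λ' → ∀ a b → InCopy λ' a b →
      Σ[ κ ∈ Copy 𝓗 G ] (𝓕𝓗 κ × MeetExactly κ λ' a b)

SupportsCore : List Graph → List Graph → Graph → Set₁
SupportsCore 𝓗 𝓛 G = Σ[ 𝓕𝓗 ∈ (Copy 𝓗 G → Set) ] Σ[ 𝓕𝓛 ∈ (Copy 𝓛 G → Set) ] IsCore 𝓗 𝓛 G 𝓕𝓗 𝓕𝓛

{-# OPTIONS --safe #-}
module Submission where

-- Start from the family of all copies in G of members of 𝓗 (red) and of 𝓛 (blue): every
-- colouring makes one of them monochromatic in its own colour.  While some member d has an
-- edge e that no member of the other colour meets exactly in e, delete d.  The family keeps
-- its Ramsey property: if d is monochromatic, give e the other colour; some member d′ ≠ d is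
-- then monochromatic, and d′ either was monochromatic before or meets d exactly in e.  The
-- surviving family T has partners everywhere, and the minimality of G does the rest.  An edge
-- in no member of T could be deleted from G.  If the edges reachable from one edge through
-- members of T were not all edges, every member of T would lie on one side of that split, and
-- splicing colourings of the two sides would make one of the two proper subgraphs Ramsey.

open import Defs hiding (sym)
open import Data.Bool using (Bool; true; false; not; _∧_; if_then_else_)
open import Data.Bool.Properties using (∧-zeroʳ; ∧-conicalʳ; not-¬) renaming (_≟_ to _≟ᵇ_)
open import Data.Empty using (⊥-elim)
open import Data.Fin using (Fin; zero; suc)
import Data.Fin.Properties as Fin
open import Data.List using (List; []; _∷_; length; map; concatMap; _++_; allFin)
open import Data.List.Membership.Propositional using (_∈_; _∉_; find; lose)
open import Data.List.Membership.Propositional.Properties using (∈-allFin; ∈-cartesianProduct⁺)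
open import Data.List.Properties using (length-removeAt′)
open import Data.List.Relation.Unary.Any as Any using (Any; here; there; _─_; any?)
open import Data.List.Relation.Unary.Any.Properties using (Any-⊎⁻; map⁺; ++⁺ˡ; ++⁺ʳ; concatMap⁺)
open import Data.Nat using (ℕ; zero; suc; _<_)
open import Data.Nat.Induction using (<-wellFounded)
open import Data.Nat.Properties using (≤-reflexive)
open import Data.Product using (Σ-syntax; _×_; _,_; proj₁; proj₂; uncurry; swap)
import Data.Product.Properties as Product
open import Data.Sum using (_⊎_; inj₁; inj₂; [_,_]′)
import Data.Sum as Sum
open import Data.Vec.Functional using () renaming (_∷_ to _∷ᶠ_)
open import Function using (_∘_; id; mk⇔)
open import Function.Definitions using (Injective)
open import Induction.WellFounded using (Acc; acc)
open import Relation.Binary.Construct.Closure.ReflexiveTransitive using (Star; ε; _◅_; _◅◅_)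
import Relation.Binary.Construct.Closure.ReflexiveTransitive as Star
open import Relation.Binary.Core using (_⇒_)
open import Relation.Binary.Definitions using (DecidableEquality)
open import Relation.Binary.PropositionalEquality using (_≡_; _≢_; _≗_; refl; sym; trans; cong; cong₂; subst₂)
open import Relation.Nullary using (¬_; Dec; yes; no; does; ¬?)
open import Relation.Nullary.Decidable
  using (map′; decidable-stable; _×-dec_; _⊎-dec_; _→-dec_; dec-true; dec-false; does-⇔)

module _ {A : Set} {P : A → Set} where

  Any-─⁻ : ∀ {x xs} (x∈xs : x ∈ xs) → Any P (xs ─ x∈xs) → Any P xs
  Any-─⁻ (here refl)  p         = there p
  Any-─⁻ (there x∈xs) (here px) = here px
  Any-─⁻ (there x∈xs) (there p) = there (Any-─⁻ x∈xs p)

  Any-─ : ∀ {x xs} (x∈xs : x ∈ xs) → Any P xs → P x ⊎ Any P (xs ─ x∈xs)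
  Any-─ (here refl)  (here px) = inj₁ px
  Any-─ (here refl)  (there p) = inj₂ p
  Any-─ (there x∈xs) (here px) = inj₂ (here px)
  Any-─ (there x∈xs) (there p) = Sum.map₂ there (Any-─ x∈xs p)

length-─-< : ∀ {A : Set} {x : A} xs (x∈xs : x ∈ xs) → length (xs ─ x∈xs) < length xs
length-─-< xs x∈xs = ≤-reflexive (sym (length-removeAt′ xs (Any.index x∈xs)))

module _ {A : Set} (Invariant : List A → Set) (Bad : List A → A → Set)
         (bad? : ∀ xs x → Dec (Bad xs x))
         (remove-bad : ∀ {x xs} (x∈xs : x ∈ xs) → Bad xs x → Invariant xs → Invariant (xs ─ x∈xs))
         where

  prune : ∀ xs → Invariant xs → Σ[ ys ∈ List A ] (Invariant ys × ¬ Any (Bad ys) ys)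
  prune xs = go xs (<-wellFounded (length xs))
    where
    go : ∀ xs → Acc _<_ (length xs) → Invariant xs → Σ[ ys ∈ List A ] (Invariant ys × ¬ Any (Bad ys) ys)
    go xs (acc shorter) inv with any? (bad? xs) xs
    ... | no none = xs , inv , none
    ... | yes some with find some
    ...   | x , x∈xs , bad = go (xs ─ x∈xs) (shorter (length-─-< xs x∈xs)) (remove-bad x∈xs bad inv)

module _ {A : Set} (_≟_ : DecidableEquality A) {xs : List A} (enumerates : ∀ x → x ∈ xs)
         {R : A → A → Set} (R? : ∀ x y → Dec (R x y)) where

  open import Data.List.Membership.DecPropositional _≟_ using (_∈?_)

  private
    module From (x : A) where

      -- z can leave the list S of vertices not yet known to be reachable from x
      Leaves : List A → A → Set
      Leaves S z = z ≡ x ⊎ Any (λ w → w ∉ S × R w z) xs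

      leaves? : ∀ S z → Dec (Leaves S z)
      leaves? S z = (z ≟ x) ⊎-dec any? (λ w → ¬? (w ∈? S) ×-dec R? w z) xs

      ReachedOutside : List A → Set
      ReachedOutside S = ∀ z → z ∉ S → Star R x z

      leave : ∀ {S z} → ReachedOutside S → Leaves S z → Star R x z
      leave reached (inj₁ refl) = ε
      leave reached (inj₂ pred) with find pred
      ... | w , _ , w∉S , r = reached w w∉S ◅◅ (r ◅ ε)

      remove-leaving : ∀ {z S} (z∈S : z ∈ S) → Leaves S z → ReachedOutside S → ReachedOutside (S ─ z∈S)
      remove-leaving {S = S} z∈S leaves reached w w∉S─z with w ∈? S
      ... | no w∉S = reached w w∉S
      ... | yes w∈S with Any-─ z∈S w∈S
      ...   | inj₁ refl = leave reached leaves
      ...   | inj₂ w∈S─z = ⊥-elim (w∉S─z w∈S─z)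

      settled : Σ[ T ∈ List A ] (ReachedOutside T × ¬ Any (Leaves T) T)
      settled = prune ReachedOutside Leaves leaves? remove-leaving xs (λ z z∉xs → ⊥-elim (z∉xs (enumerates z)))

      unreached : List A
      unreached = proj₁ settled

      unreached-closed : ∀ {u v} → u ∉ unreached → Star R u v → v ∉ unreached
      unreached-closed u∉T ε = u∉T
      unreached-closed {u} u∉T (r ◅ path) = unreached-closed w∉T path
        where
        w∉T : _ ∉ unreached
        w∉T w∈T = proj₂ (proj₂ settled) (lose w∈T (inj₂ (lose (enumerates u) (u∉T , r))))

      x∉unreached : x ∉ unreached
      x∉unreached x∈T = proj₂ (proj₂ settled) (lose x∈T (inj₁ refl))

  star? : ∀ x y → Dec (Star R x y)
  star? x y with y ∈? From.unreached x
  ... | yes y∈T = no λ path → From.unreached-closed x (From.x∉unreached x) path y∈T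
  ... | no y∉T  = yes (proj₁ (proj₂ (From.settled x)) y y∉T)

allFunctions : ∀ k m → List (Fin k → Fin m)
allFunctions zero    m = (λ ()) ∷ []
allFunctions (suc k) m = concatMap (λ a → map (a ∷ᶠ_) (allFunctions k m)) (allFin m)

allFunctions-complete : ∀ {k m} (f : Fin k → Fin m) → Any (f ≗_) (allFunctions k m)
allFunctions-complete {zero}  f = here (λ ())
allFunctions-complete {suc k} f =
  concatMap⁺ _ (lose (∈-allFin (f zero)) (map⁺ (Any.map extend (allFunctions-complete (f ∘ suc)))))
  where
  extend : ∀ {g} → f ∘ suc ≗ g → f ≗ (f zero ∷ᶠ g)
  extend eq zero    = refl
  extend eq (suc i) = eq i

module _ (H G : Graph) where

  IsEmbedding : (Fin (n H) → Fin (n G)) → Set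
  IsEmbedding g = Injective _≡_ _≡_ g × (∀ u v → Edge H u v → Edge G (g u) (g v))

  isEmbedding? : ∀ g → Dec (IsEmbedding g)
  isEmbedding? g =
    injective? ×-dec (Fin.all? λ u → Fin.all? λ v → (adj H u v ≟ᵇ true) →-dec (adj G (g u) (g v) ≟ᵇ true))
    where
    injective? : Dec (Injective _≡_ _≡_ g)
    injective? = map′ (λ inj {x} {y} → inj x y) (λ inj x y → inj {x} {y})
                   (Fin.all? λ x → Fin.all? λ y → (g x Fin.≟ g y) →-dec (x Fin.≟ y))

  IsEmbedding-resp-≗ : ∀ {g g′} → g ≗ g′ → IsEmbedding g → IsEmbedding g′
  IsEmbedding-resp-≗ eq (inj , pres) =
    (λ {x} {y} e → inj (trans (eq x) (trans e (sym (eq y))))) ,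
    (λ u v e → subst₂ (Edge G) (eq u) (eq v) (pres u v e))

  embeddingsWithMap : (Fin (n H) → Fin (n G)) → List (Emb H G)
  embeddingsWithMap g with isEmbedding? g
  ... | yes (inj , pres) = record { f = g ; inj = inj ; pres = pres } ∷ []
  ... | no _             = []

  embeddings : List (Emb H G)
  embeddings = concatMap embeddingsWithMap (allFunctions (n H) (n G))

  embeddings-complete : (φ : Emb H G) → Any (λ ψ → f φ ≗ f ψ) embeddings
  embeddings-complete φ = concatMap⁺ embeddingsWithMap (Any.map found (allFunctions-complete (f φ)))
    where
    found : ∀ {g} → f φ ≗ g → Any (λ ψ → f φ ≗ f ψ) (embeddingsWithMap g)
    found {g} eq with isEmbedding? g
    ... | yes _    = here eq
    ... | no ¬emb = ⊥-elim (¬emb (IsEmbedding-resp-≗ eq (inj φ , pres φ)))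

InImage-resp-≗ : ∀ {H G} {φ ψ : Emb H G} → f φ ≗ f ψ → InImage ψ ⇒ InImage φ
InImage-resp-≗ eq (u , v , e , refl , refl) = u , v , e , eq u , eq v

module _ (G : Graph) where

  copies : (𝓕 : List Graph) → List (Copy 𝓕 G)
  copies []      = []
  copies (H ∷ 𝓕) = map (λ φ → H , here refl , φ) (embeddings H G) ++ map weaken (copies 𝓕)
    where
    weaken : Copy 𝓕 G → Copy (H ∷ 𝓕) G
    weaken (H′ , H′∈𝓕 , φ) = H′ , there H′∈𝓕 , φ

  copies-complete : ∀ {𝓕} (κ : Copy 𝓕 G) → Any (λ κ′ → InCopy κ′ ⇒ InCopy κ) (copies 𝓕)
  copies-complete (H , here refl , φ) =
    ++⁺ˡ (map⁺ (Any.map (λ {ψ} → InImage-resp-≗ {φ = φ} {ψ}) (embeddings-complete H G φ)))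
  copies-complete {H ∷ 𝓕} (H′ , there H′∈𝓕 , φ) =
    ++⁺ʳ _ (map⁺ (copies-complete (H′ , H′∈𝓕 , φ)))

module _ {k : ℕ} where

  samePair? : (x y a b : Fin k) → Dec (SamePair x y a b)
  samePair? x y a b = ((x Fin.≟ a) ×-dec (y Fin.≟ b)) ⊎-dec ((x Fin.≟ b) ×-dec (y Fin.≟ a))

  SamePair-swap : ∀ {x y a b : Fin k} → SamePair x y a b → SamePair y x a b
  SamePair-swap (inj₁ (x≡a , y≡b)) = inj₂ (y≡b , x≡a)
  SamePair-swap (inj₂ (x≡b , y≡a)) = inj₁ (y≡a , x≡b)

  SamePair-sym : ∀ {x y a b : Fin k} → SamePair x y a b → SamePair a b x y
  SamePair-sym (inj₁ (refl , refl)) = inj₁ (refl , refl)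
  SamePair-sym (inj₂ (refl , refl)) = inj₂ (refl , refl)

module _ {H G : Graph} (φ : Emb H G) where

  inImage? : ∀ a b → Dec (InImage φ a b)
  inImage? a b = Fin.any? λ u → Fin.any? λ v →
    (adj H u v ≟ᵇ true) ×-dec ((f φ u Fin.≟ a) ×-dec (f φ v Fin.≟ b))

  InImage-sym : ∀ {a b} → InImage φ a b → InImage φ b a
  InImage-sym (u , v , e , fu≡a , fv≡b) = v , u , trans (Graph.sym H v u) e , fv≡b , fu≡a

  InImage-SamePair : ∀ {x y a b} → SamePair x y a b → InImage φ a b → InImage φ x y
  InImage-SamePair (inj₁ (refl , refl)) = id
  InImage-SamePair (inj₂ (refl , refl)) = InImage-sym

record EdgeSelection (G : Graph) : Set₁ where
  field
    Selected     : Fin (n G) → Fin (n G) → Set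
    selected?    : ∀ x y → Dec (Selected x y)
    selected-sym : ∀ {x y} → Selected x y → Selected y x
open EdgeSelection

∁ˢ : ∀ {G} → EdgeSelection G → EdgeSelection G
∁ˢ s = record
  { Selected     = λ x y → ¬ Selected s x y
  ; selected?    = λ x y → ¬? (selected? s x y)
  ; selected-sym = λ ¬sel sel → ¬sel (selected-sym s sel)
  }

pairSelection : ∀ {G} (a b : Fin (n G)) → EdgeSelection G
pairSelection a b = record
  { Selected     = λ x y → SamePair x y a b
  ; selected?    = λ x y → samePair? x y a b
  ; selected-sym = SamePair-swap
  }

module _ (G : Graph) (s : EdgeSelection G) where

  restrict : Graph
  restrict = record
    { n      = n G
    ; adj    = λ x y → does (selected? s x y) ∧ adj G x y
    ; sym    = λ x y → cong₂ _∧_ (does-⇔ (mk⇔ (selected-sym s) (selected-sym s)) (selected? s x y) (selected? s y x))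
                                  (Graph.sym G x y)
    ; irrefl = λ x → trans (cong (does (selected? s x x) ∧_) (irrefl G x)) (∧-zeroʳ _)
    }

  restrict-Emb : Emb restrict G
  restrict-Emb = record { f = id ; inj = id ; pres = λ u v → ∧-conicalʳ _ _ }

  restrict-Proper : ∀ {a b} → ¬ Selected s a b → Edge G a b → Proper restrict-Emb
  restrict-Proper {a} {b} unselected ab = inj₂ (a , b , ab , not-in-restriction)
    where
    not-in-restriction : ¬ InImage restrict-Emb a b
    not-in-restriction (_ , _ , e , refl , refl) with selected? s a b | e
    ... | yes selected | _ = unselected selected
    ... | no _         | ()

  Emb-restrict : ∀ {H} (φ : Emb H G) → (∀ x y → InImage φ x y → Selected s x y) → Emb H restrict
  Emb-restrict {H} φ within = record { f = f φ ; inj = inj φ ; pres = pres′ }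
    where
    pres′ : ∀ u v → Edge H u v → Edge restrict (f φ u) (f φ v)
    pres′ u v e rewrite dec-true (selected? s (f φ u) (f φ v)) (within _ _ (u , v , e , refl , refl)) = pres φ u v e

module _ {G : Graph} (s : EdgeSelection G) where

  splice : Colouring G → Colouring G → Colouring G
  splice (c , c-sym) (c′ , c′-sym) = spliced , spliced-sym
    where
    spliced : Fin (n G) → Fin (n G) → Bool
    spliced x y = if does (selected? s x y) then c x y else c′ x y

    spliced-sym : ∀ x y → spliced x y ≡ spliced y x
    spliced-sym x y
      rewrite does-⇔ (mk⇔ (selected-sym s) (selected-sym s)) (selected? s x y) (selected? s y x)
            | c-sym x y | c′-sym x y = refl

  splice-in : ∀ χ χ′ {x y} → Selected s x y → proj₁ (splice χ χ′) x y ≡ proj₁ χ x y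
  splice-in χ χ′ {x} {y} sel rewrite dec-true (selected? s x y) sel = refl

  splice-out : ∀ χ χ′ {x y} → ¬ Selected s x y → proj₁ (splice χ χ′) x y ≡ proj₁ χ′ x y
  splice-out χ χ′ {x} {y} ¬sel rewrite dec-false (selected? s x y) ¬sel = refl

uniform : ∀ G → Bool → Colouring G
uniform G b = (λ _ _ → b) , (λ _ _ → refl)

module _ (𝓗 𝓛 : List Graph) (G : Graph) where

  ColouredCopy : Set
  ColouredCopy = Copy 𝓗 G ⊎ Copy 𝓛 G

  colour : ColouredCopy → Bool
  colour (inj₁ _) = true
  colour (inj₂ _) = false

  Edges : ColouredCopy → Fin (n G) → Fin (n G) → Set
  Edges (inj₁ κ)  = InCopy κ
  Edges (inj₂ λ′) = InCopy λ′

  edges? : ∀ d x y → Dec (Edges d x y)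
  edges? (inj₁ (_ , _ , φ)) = inImage? φ
  edges? (inj₂ (_ , _ , φ)) = inImage? φ

  Edges-sym : ∀ d {x y} → Edges d x y → Edges d y x
  Edges-sym (inj₁ (_ , _ , φ)) = InImage-sym φ
  Edges-sym (inj₂ (_ , _ , φ)) = InImage-sym φ

  Edges-SamePair : ∀ d {x y a b} → SamePair x y a b → Edges d a b → Edges d x y
  Edges-SamePair (inj₁ (_ , _ , φ)) = InImage-SamePair φ
  Edges-SamePair (inj₂ (_ , _ , φ)) = InImage-SamePair φ

  Within : EdgeSelection G → ColouredCopy → Set
  Within s d = ∀ x y → Edges d x y → Selected s x y

  within? : ∀ s d → Dec (Within s d)
  within? s d = Fin.all? λ x → Fin.all? λ y → edges? d x y →-dec selected? s x y

  Mono : Colouring G → ColouredCopy → Set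
  Mono χ d = ∀ x y → Edges d x y → proj₁ χ x y ≡ colour d

  mono? : ∀ χ d → Dec (Mono χ d)
  mono? χ d = Fin.all? λ x → Fin.all? λ y → edges? d x y →-dec (proj₁ χ x y ≟ᵇ colour d)

  Mono-splice-in : ∀ s χ χ′ d → Within s d → Mono (splice s χ χ′) d → Mono χ d
  Mono-splice-in s χ χ′ d inside mono x y e = trans (sym (splice-in s χ χ′ (inside x y e))) (mono x y e)

  Mono-splice-out : ∀ s χ χ′ d → Within (∁ˢ s) d → Mono (splice s χ χ′) d → Mono χ′ d
  Mono-splice-out s χ χ′ d outside mono x y e = trans (sym (splice-out s χ χ′ (outside x y e))) (mono x y e)

  MeetsExactly : ColouredCopy → ColouredCopy → Fin (n G) → Fin (n G) → Set
  MeetsExactly d d′ a b = ∀ x y →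
    ((Edges d x y × Edges d′ x y) → SamePair x y a b) × (SamePair x y a b → Edges d x y × Edges d′ x y)

  meetsExactly? : ∀ d d′ a b → Dec (MeetsExactly d d′ a b)
  meetsExactly? d d′ a b = Fin.all? λ x → Fin.all? λ y →
    ((edges? d x y ×-dec edges? d′ x y) →-dec samePair? x y a b) ×-dec
    (samePair? x y a b →-dec (edges? d x y ×-dec edges? d′ x y))

  MeetsExactly-comm : ∀ d d′ {a b} → MeetsExactly d d′ a b → MeetsExactly d′ d a b
  MeetsExactly-comm d d′ meets x y = (λ (e′ , e) → proj₁ (meets x y) (e , e′)) , (λ p → swap (proj₂ (meets x y) p))

  IsPartner : ColouredCopy → Fin (n G) → Fin (n G) → ColouredCopy → Set
  IsPartner d a b d′ = colour d′ ≢ colour d × MeetsExactly d d′ a b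

  Partner : List ColouredCopy → ColouredCopy → Fin (n G) → Fin (n G) → Set
  Partner S d a b = Any (IsPartner d a b) S

  partner? : ∀ S d a b → Dec (Partner S d a b)
  partner? S d a b = any? (λ d′ → ¬? (colour d′ ≟ᵇ colour d) ×-dec meetsExactly? d d′ a b) S

  RamseyFamily : List ColouredCopy → Set
  RamseyFamily S = (χ : Colouring G) → Any (Mono χ) S

  RamseyFamily-copies : Ramsey 𝓗 𝓛 G → RamseyFamily (map inj₁ (copies G 𝓗) ++ map inj₂ (copies G 𝓛))
  RamseyFamily-copies ramsey χ with ramsey χ
  ... | inj₁ (κ , mono)  = ++⁺ˡ (map⁺ (Any.map (λ sub x y e → mono x y (sub e)) (copies-complete G κ)))
  ... | inj₂ (λ′ , mono) = ++⁺ʳ _ (map⁺ (Any.map (λ sub x y e → mono x y (sub e)) (copies-complete G λ′)))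

  -- Only ab changes colour, so a copy avoiding ab keeps its colours, and a copy of the other
  -- colour through ab shares no further edge with the monochromatic d.
  module _ (χ : Colouring G) (d : ColouredCopy) (a b : Fin (n G)) where

    ab-only : EdgeSelection G
    ab-only = pairSelection a b

    opposite : Colouring G
    opposite = uniform G (not (colour d))

    recoloured : Colouring G
    recoloured = splice ab-only opposite χ

    recoloured-ab : proj₁ recoloured a b ≡ not (colour d)
    recoloured-ab = splice-in ab-only opposite χ (inj₁ (refl , refl))

    Mono-recoloured : Edges d a b → Mono χ d → ∀ {d′} → Mono recoloured d′ → Mono χ d′ ⊎ IsPartner d a b d′
    Mono-recoloured ab∈d d-mono {d′} mono′ with colour d′ ≟ᵇ colour d | edges? d′ a b
    ... | yes same | _ = inj₁ (Mono-splice-out ab-only opposite χ d′ avoids mono′)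
      where
      avoids : Within (∁ˢ ab-only) d′
      avoids x y e p = not-¬ refl (trans (sym same) (trans (sym (mono′ x y e)) (splice-in ab-only opposite χ p)))
    ... | no differ | no ab∉d′ = inj₁ (Mono-splice-out ab-only opposite χ d′ avoids mono′)
      where
      avoids : Within (∁ˢ ab-only) d′
      avoids x y e p = ab∉d′ (Edges-SamePair d′ (SamePair-sym p) e)
    ... | no differ | yes ab∈d′ = inj₂ (differ , meets)
      where
      meets : MeetsExactly d d′ a b
      meets x y = common , λ p → Edges-SamePair d p ab∈d , Edges-SamePair d′ p ab∈d′
        where
        common : Edges d x y × Edges d′ x y → SamePair x y a b
        common (e , e′) with samePair? x y a b
        ... | yes p = p
        ... | no ¬p =
          ⊥-elim (differ (trans (sym (mono′ x y e′)) (trans (splice-out ab-only opposite χ ¬p) (d-mono x y e))))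

  RamseyFamily-─ : ∀ {S d a b} → RamseyFamily S → (d∈S : d ∈ S) → Edges d a b → ¬ Partner S d a b →
                   RamseyFamily (S ─ d∈S)
  RamseyFamily-─ {S} {d} {a} {b} ramsey d∈S ab∈d lonely χ with Any-─ d∈S (ramsey χ)
  ... | inj₂ found = found
  ... | inj₁ d-mono with Any-─ d∈S (ramsey (recoloured χ d a b))
  ...   | inj₁ d-mono′ = ⊥-elim (not-¬ refl (trans (sym (d-mono′ a b ab∈d)) (recoloured-ab χ d a b)))
  ...   | inj₂ found′ with Any-⊎⁻ (Any.map (Mono-recoloured χ d a b ab∈d d-mono) found′)
  ...     | inj₁ found  = found
  ...     | inj₂ partner = ⊥-elim (lonely (Any-─⁻ d∈S partner))

  Partnered : List ColouredCopy → Set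
  Partnered T = ∀ {d} → d ∈ T → ∀ a b → Edges d a b → Partner T d a b

  Unpartnered : List ColouredCopy → ColouredCopy → Set
  Unpartnered S d = Σ[ a ∈ Fin (n G) ] Σ[ b ∈ Fin (n G) ] (Edges d a b × ¬ Partner S d a b)

  unpartnered? : ∀ S d → Dec (Unpartnered S d)
  unpartnered? S d = Fin.any? λ a → Fin.any? λ b → edges? d a b ×-dec ¬? (partner? S d a b)

  partneredRamseyFamily : Ramsey 𝓗 𝓛 G → Σ[ T ∈ List ColouredCopy ] (RamseyFamily T × Partnered T)
  partneredRamseyFamily ramsey =
    let T , ramsey-T , settled =
          prune RamseyFamily Unpartnered unpartnered? drop-unpartnered _ (RamseyFamily-copies ramsey)
    in T , ramsey-T , λ {d} d∈T a b ab∈d →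
         decidable-stable (partner? T d a b) λ lonely → settled (lose d∈T (a , b , ab∈d , lonely))
    where
    drop-unpartnered : ∀ {d S} (d∈S : d ∈ S) → Unpartnered S d → RamseyFamily S → RamseyFamily (S ─ d∈S)
    drop-unpartnered d∈S (_ , _ , ab∈d , lonely) ramsey = RamseyFamily-─ ramsey d∈S ab∈d lonely

  Ramsey-restrict : ∀ s → (∀ χ → Σ[ d ∈ ColouredCopy ] (Within s d × Mono χ d)) → Ramsey 𝓗 𝓛 (restrict G s)
  Ramsey-restrict s mono-within χ with mono-within χ
  ... | inj₁ (H , H∈𝓗 , φ) , inside , mono = inj₁ ((H , H∈𝓗 , Emb-restrict G s φ inside) , mono)
  ... | inj₂ (L , L∈𝓛 , φ) , inside , mono = inj₂ ((L , L∈𝓛 , Emb-restrict G s φ inside) , mono)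

  module _ (T : List ColouredCopy) (ramsey : RamseyFamily T)
           (minimal : ∀ (G′ : Graph) (φ : Emb G′ G) → Proper φ → ¬ Ramsey 𝓗 𝓛 G′) where

    restrict-not-Ramsey : ∀ s {a b} → ¬ Selected s a b → Edge G a b → ¬ Ramsey 𝓗 𝓛 (restrict G s)
    restrict-not-Ramsey s unselected ab = minimal _ (restrict-Emb G s) (restrict-Proper G s unselected ab)

    covered : ∀ a b → Edge G a b → Any (λ d → Edges d a b) T
    covered a b ab = decidable-stable (any? (λ d → edges? d a b) T) λ uncovered →
      restrict-not-Ramsey (∁ˢ (pairSelection a b)) (λ ¬ab → ¬ab (inj₁ (refl , refl))) ab
        (Ramsey-restrict (∁ˢ (pairSelection a b)) (avoiding uncovered))
      where
      avoiding : ¬ Any (λ d → Edges d a b) T →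
                 ∀ χ → Σ[ d ∈ ColouredCopy ] (Within (∁ˢ (pairSelection a b)) d × Mono χ d)
      avoiding uncovered χ with find (ramsey χ)
      ... | d , d∈T , mono = d , (λ x y e p → uncovered (lose d∈T (Edges-SamePair d (SamePair-sym p) e))) , mono

    -- Colour the two sides independently and splice; the monochromatic member lies on one side.
    Ramsey-split : ∀ s → (∀ {d} → d ∈ T → Within s d ⊎ Within (∁ˢ s) d) →
                   ¬ Ramsey 𝓗 𝓛 (restrict G (∁ˢ s)) → Ramsey 𝓗 𝓛 (restrict G s)
    Ramsey-split s separated ∁s-not-Ramsey = Ramsey-restrict s mono-inside
      where
      mono-inside : ∀ χ → Σ[ d ∈ ColouredCopy ] (Within s d × Mono χ d)
      mono-inside χ with any? (λ d → within? s d ×-dec mono? χ d) T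
      ... | yes found = Any.satisfied found
      ... | no none   = ⊥-elim (∁s-not-Ramsey (Ramsey-restrict (∁ˢ s) mono-outside))
        where
        mono-outside : ∀ χ′ → Σ[ d ∈ ColouredCopy ] (Within (∁ˢ s) d × Mono χ′ d)
        mono-outside χ′ with find (ramsey (splice s χ χ′))
        ... | d , d∈T , mono with separated d∈T
        ...   | inj₁ inside  = ⊥-elim (none (lose d∈T (inside , Mono-splice-in s χ χ′ d inside mono)))
        ...   | inj₂ outside = d , outside , Mono-splice-out s χ χ′ d outside mono

    Pair : Set
    Pair = Fin (n G) × Fin (n G)

    Linked : Pair → Pair → Set
    Linked p q = Any (λ d → uncurry (Edges d) p × uncurry (Edges d) q) T

    linked? : ∀ p q → Dec (Linked p q)
    linked? (a , b) (c , d) = any? (λ d₀ → edges? d₀ a b ×-dec edges? d₀ c d) T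

    linked-reachable? : ∀ p q → Dec (Star Linked p q)
    linked-reachable? =
      star? (Product.≡-dec Fin._≟_ Fin._≟_) (λ (x , y) → ∈-cartesianProduct⁺ (∈-allFin x) (∈-allFin y)) linked?

    reachedFrom : Pair → EdgeSelection G
    reachedFrom p = record
      { Selected     = λ x y → Star Linked p (x , y) ⊎ Star Linked p (y , x)
      ; selected?    = λ x y → linked-reachable? p (x , y) ⊎-dec linked-reachable? p (y , x)
      ; selected-sym = Sum.swap
      }

    reachedFrom-separates : ∀ p {d} → d ∈ T → Within (reachedFrom p) d ⊎ Within (∁ˢ (reachedFrom p)) d
    reachedFrom-separates p {d} d∈T
      with Fin.any? (λ x → Fin.any? λ y → edges? d x y ×-dec selected? (reachedFrom p) x y)
    ... | no none = inj₂ λ x y e reached → none (x , y , e , reached)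
    ... | yes (x₀ , y₀ , e₀ , inj₁ path) = inj₁ λ x y e → inj₁ (path ◅◅ (lose d∈T (e₀ , e) ◅ ε))
    ... | yes (x₀ , y₀ , e₀ , inj₂ path) =
      inj₁ λ x y e → inj₁ (path ◅◅ (lose d∈T (Edges-sym d e₀ , e) ◅ ε))

    connected : ∀ a b c d → Edge G a b → Edge G c d → Star Linked (a , b) (c , d)
    connected a b c d ab cd with linked-reachable? (a , b) (c , d) | linked-reachable? (a , b) (d , c)
    ... | yes path | _        = path
    ... | no _     | yes path = path ◅◅ (Any.map (λ {d₀} cd∈d₀ → Edges-sym d₀ cd∈d₀ , cd∈d₀) (covered c d cd) ◅ ε)
    ... | no ¬cd   | no ¬dc   =
      ⊥-elim (restrict-not-Ramsey R [ ¬cd , ¬dc ]′ cd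
        (Ramsey-split R (reachedFrom-separates (a , b)) (restrict-not-Ramsey (∁ˢ R) (λ ¬ab → ¬ab (inj₁ ε)) ab)))
      where
      R : EdgeSelection G
      R = reachedFrom (a , b)

    ByColour : (ColouredCopy → Set) → Set
    ByColour Q = (Σ[ κ ∈ Copy 𝓗 G ] (inj₁ κ ∈ T × Q (inj₁ κ))) ⊎ (Σ[ λ′ ∈ Copy 𝓛 G ] (inj₂ λ′ ∈ T × Q (inj₂ λ′)))

    byColour : ∀ {Q} → Any Q T → ByColour Q
    byColour found with find found
    ... | inj₁ κ  , κ∈T  , q = inj₁ (κ , κ∈T , q)
    ... | inj₂ λ′ , λ′∈T , q = inj₂ (λ′ , λ′∈T , q)

    supportsCore : Partnered T → SupportsCore 𝓗 𝓛 G
    supportsCore partnered = (λ κ → inj₁ κ ∈ T) , (λ λ′ → inj₂ λ′ ∈ T) , record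
      { covering  = λ a b ab → byColour (covered a b ab)
      ; connected = λ a b c d ab cd → Star.map byColour (connected a b c d ab cd)
      ; H-side    = λ κ κ∈T a b ab → red-partner κ a b (byColour (partnered κ∈T a b ab))
      ; L-side    = λ λ′ λ′∈T a b ab → blue-partner λ′ a b (byColour (partnered λ′∈T a b ab))
      }
      where
      red-partner : ∀ κ a b → ByColour (IsPartner (inj₁ κ) a b) →
                    Σ[ λ′ ∈ Copy 𝓛 G ] (inj₂ λ′ ∈ T × MeetExactly κ λ′ a b)
      red-partner _ _ _ (inj₁ (_ , _ , differ , _))    = ⊥-elim (differ refl)
      red-partner _ _ _ (inj₂ (λ′ , λ′∈T , _ , meets)) = λ′ , λ′∈T , meets

      blue-partner : ∀ λ′ a b → ByColour (IsPartner (inj₂ λ′) a b) →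
                     Σ[ κ ∈ Copy 𝓗 G ] (inj₁ κ ∈ T × MeetExactly κ λ′ a b)
      blue-partner λ′ _ _ (inj₁ (κ , κ∈T , _ , meets)) = κ , κ∈T , MeetsExactly-comm (inj₂ λ′) (inj₁ κ) meets
      blue-partner _  _ _ (inj₂ (_ , _ , differ , _))   = ⊥-elim (differ refl)

lemma3p2 : (𝓗 𝓛 : List Graph) (G : Graph) →
    Ramsey 𝓗 𝓛 G →
    (∀ (G' : Graph) (φ : Emb G' G) → Proper φ → ¬ Ramsey 𝓗 𝓛 G') →
    SupportsCore 𝓗 𝓛 G
lemma3p2 𝓗 𝓛 G ramsey minimal =
  let T , T-ramsey , T-partnered = partneredRamseyFamily 𝓗 𝓛 G ramsey
  in supportsCore 𝓗 𝓛 G T T-ramsey minimal T-partnered
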